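{- Let $k\geq 2$ and let $\alpha_1,\ldots,\alpha_{2k}$ be positive integers, and let $G=C(\alpha_1,\alpha_2,\ldots,\alpha_{2k})$. Then: (1) if $\alpha_{2k}=1$, the eccentricity matrix $\epsilon(G)$ is irreducible; (2) if $\alpha_{2k}\geq 2$, the eccentricity matrix $\epsilon(G)$ is reducible.
   Context: All graphs are finite, simple. For a positive integer $\alpha$, $K_\alpha$ is the complete graph on $\alpha$ vertices and $\overline{H}$ denotes the complement of a graph $H$. For positive integers $\alpha_1,\ldots,\alpha_l$ the graph $C(\alpha_1,\ldots,\alpha_l)$ is defined recursively by $C(\alpha_1)=\overline{K_{\alpha_1}}$ and $C(\alpha_1,\ldots,\alpha_i)=\overline{C(\alpha_1,\ldots,\alpha_{i-1})\cup K_{\alpha_i}}$ for $2\leq i\leq l$ (disjoint union, then complement); it has $\sum_i\alpha_i$ vertices. For a connected graph $G$ with distance $d(u,v)$ and eccentricity $e(u)=\max_v d(u,v)$, the eccentricity matrix $\epsilon(G)$ is the matrix indexed by $V(G)$ with $(u,v)$-entry $d(u,v)$ if $d(u,v)=\min\{e(u),e(v)\}$ and $0$ otherwise. A nonnegative $n\times n$ matrix $N$ is reducible if there is a permutation matrix $P$ with $PNP^T=\begin{pmatrix}N_{11}&N_{12}\\0&N_{22}\end{pmatrix}$ where $N_{11}$ is $r\times r$ with $1\leq r<n$; otherwise it is irreducible. -}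

module Defs where

open import Data.Nat using (ℕ; zero; suc; _+_; _≤_; _<_; _⊔_; _⊓_; _≡ᵇ_)

open import Data.Bool using (Bool; true; false; not; _∧_; _∨_; if_then_else_)
open import Data.Fin using (Fin; toℕ; fromℕ; inject₁; splitAt)
open import Data.Fin.Permutation using (Permutation′; _⟨$⟩ʳ_)
open import Data.Sum using (inj₁; inj₂)
open import Data.List using (List; foldr; allFin)
open import Data.Bool.ListAction using (any)
open import Data.Product using (Σ; _×_)
open import Relation.Nullary using (¬_; does)
open import Relation.Binary.PropositionalEquality using (_≡_)
import Data.Fin as F

record Graph : Set where
  field
    size : ℕ
    adj  : Fin size → Fin size → Bool
open Graph public

_==_ : ∀ {n} → Fin n → Fin n → Bool
u == v = does (u F.≟ v)

emptyG : ℕ → Graph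
emptyG a = record { size = a ; adj = λ _ _ → false }

completeG : ℕ → Graph
completeG a = record { size = a ; adj = λ u v → not (u == v) }

complG : Graph → Graph
complG G = record { size = size G ; adj = λ u v → not (adj G u v) ∧ not (u == v) }

unionG : Graph → Graph → Graph
unionG G H = record { size = size G + size H ; adj = a }
  where
  a : Fin (size G + size H) → Fin (size G + size H) → Bool
  a u v with splitAt (size G) u | splitAt (size G) v
  ... | inj₁ x | inj₁ y = adj G x y
  ... | inj₂ x | inj₂ y = adj H x y
  ... | _      | _      = false

-- C(α_1,…,α_l) for α : Fin l → ℕ (α i is α_{i+1}).
-- C(α_1) = complement of K_{α_1};
-- C(α_1..α_i) = complement of (C(α_1..α_{i-1}) ∪ K_{α_i}).
-- (The case l = 0 is a dummy value and never used.)
C : (l : ℕ) → (Fin l → ℕ) → Graph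
C zero α = emptyG 0
C (suc zero) α = complG (completeG (α Fin.zero))
C (suc (suc l)) α =
  complG (unionG (C (suc l) (λ i → α (inject₁ i))) (completeG (α (fromℕ (suc l)))))

lastEntry : (l : ℕ) → (Fin l → ℕ) → ℕ
lastEntry zero α = 0
lastEntry (suc l) α = α (fromℕ l)

reach : (G : Graph) → ℕ → Fin (size G) → Fin (size G) → Bool
reach G zero u v = u == v
reach G (suc m) u v =
  reach G m u v ∨ any (λ w → reach G m u w ∧ adj G w v) (allFin (size G))

-- distance d(u,v): least m with a walk of length m from u to v
-- (searched over m < size G; returns size G if v is unreachable, which
-- never happens in a connected graph).
dist : (G : Graph) → Fin (size G) → Fin (size G) → ℕ
dist G u v = go (size G) 0
  where
  go : ℕ → ℕ → ℕ
  go zero m = m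
  go (suc f) m = if reach G m u v then m else go f (suc m)

ecc : (G : Graph) → Fin (size G) → ℕ
ecc G u = foldr (λ v acc → dist G u v ⊔ acc) 0 (allFin (size G))

eccMatrix : (G : Graph) → Fin (size G) → Fin (size G) → ℕ
eccMatrix G u v =
  if dist G u v ≡ᵇ (ecc G u ⊓ ecc G v) then dist G u v else 0

-- Reducible n×n nonnegative matrix: a permutation σ (P is its permutation
-- matrix, (P N Pᵀ)_{ij} = N_{σ i, σ j}) and 1 ≤ r < n such that the
-- lower-left (n-r)×r block of P N Pᵀ is zero.
Reducible : {n : ℕ} → (Fin n → Fin n → ℕ) → Set
Reducible {n} N =
  Σ (Permutation′ n) λ σ → Σ ℕ λ r → 1 ≤ r × r < n ×
    (∀ (i j : Fin n) → r ≤ toℕ i → toℕ j < r → N (σ ⟨$⟩ʳ i) (σ ⟨$⟩ʳ j) ≡ 0)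

Irreducible : {n : ℕ} → (Fin n → Fin n → ℕ) → Set
Irreducible N = ¬ Reducible N

{-# OPTIONS --safe #-}
-- Write G = C(α₁,…,α_l) as the complement of H ∪ K_a with H = C(α₁,…,α_{l-1})
-- and a = α_l: every vertex of H is adjacent in G to each of the a new
-- vertices, and the new vertices are pairwise non-adjacent.
-- If a = 1 the new vertex w has eccentricity 1, so ε(G) has nonzero entries
-- (w,v) and (v,w) for every v ≠ w; w then connects both blocks of any
-- putative reduction.
-- If a ≥ 2, each new vertex is at distance 2 from another new vertex, and each
-- old vertex is at distance 2 from one of its H-neighbours (for l ≥ 3, H has
-- no isolated vertex), so all eccentricities are at least 2 while new–old
-- distances are 1: the new-to-old block of ε(G) vanishes.
module Submission where

open import Defs
open import Data.Bool using (Bool; true; false; _∧_; _∨_)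
open import Data.Bool.ListAction using (any)
open import Data.Bool.Properties using (∨-zeroʳ; if-cong)
open import Data.Empty using (⊥; ⊥-elim)
open import Data.Fin as Fin using (Fin; toℕ; fromℕ<; reduce≥; punchIn; splitAt; inject₁; _↑ˡ_; _↑ʳ_)
open import Data.Fin.Permutation as Perm using (_⟨$⟩ʳ_; _⟨$⟩ˡ_; inverseˡ; inverseʳ)
open import Data.Fin.Properties
  using (splitAt-↑ˡ; splitAt-↑ʳ; splitAt⁻¹-↑ˡ; splitAt⁻¹-↑ʳ; splitAt-<; splitAt-≥; toℕ-fromℕ<;
         punchInᵢ≢i; ↑ˡ-injective; ↑ʳ-injective)
open import Data.List using (List; []; _∷_; foldr; allFin)
open import Data.List.Membership.Propositional using (_∈_)
open import Data.List.Membership.Propositional.Properties using (∈-allFin)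
open import Data.List.Relation.Unary.Any using (here; there)
open import Data.Nat as ℕ using (ℕ; suc; zero; z≤n; s≤s; _+_; _*_; _≤_; _<_; _⊔_; _⊓_)
open import Data.Nat.Properties
  using (≤-trans; ≤-reflexive; ≤-antisym; <⇒≤; <⇒≢; <⇒≱; ≤-<-connex; m≤m+n; m<m+n; *-monoʳ-≤;
         n≤1+n; m≤m⊔n; m≤n⊔m; ⊔-lub; ⊓-glb; m≤n⇒m⊓n≡m; m≥n⇒m⊓n≡n)
open import Data.Product using (∃; _×_; _,_)
open import Data.Sum using (_⊎_; inj₁; inj₂; [_,_]′)
open import Function using (_∘_)
open import Relation.Nullary using (yes; no)
open import Relation.Nullary.Decidable using (dec-true; dec-false)
open import Relation.Binary.PropositionalEquality
  using (_≡_; _≢_; refl; sym; trans; cong; subst; subst₂)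

any-true : ∀ {A : Set} (p : A → Bool) {xs : List A} {x : A} → x ∈ xs → p x ≡ true → any p xs ≡ true
any-true p {y ∷ ys} (here refl) px rewrite px = refl
any-true p {y ∷ ys} (there x∈ys) px rewrite any-true p x∈ys px = ∨-zeroʳ (p y)

any-false : ∀ {A : Set} (p : A → Bool) (xs : List A) → (∀ x → p x ≡ false) → any p xs ≡ false
any-false p []       _  = refl
any-false p (y ∷ ys) px rewrite px y = any-false p ys px

↑ˡ⊎↑ʳ : ∀ s {a} (u : Fin (s + a)) → (∃ λ x → u ≡ x ↑ˡ a) ⊎ (∃ λ y → u ≡ s ↑ʳ y)
↑ˡ⊎↑ʳ s u with splitAt s u in eq
... | inj₁ x = inj₁ (x , sym (splitAt⁻¹-↑ˡ eq))
... | inj₂ y = inj₂ (y , sym (splitAt⁻¹-↑ʳ eq))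

↑ˡ≢↑ʳ : ∀ {s a} (x : Fin s) (y : Fin a) → x ↑ˡ a ≢ s ↑ʳ y
↑ˡ≢↑ʳ {s} {a} x y e
  with () ← trans (sym (splitAt-↑ˡ s x a)) (trans (cong (splitAt s) e) (splitAt-↑ʳ s a y))

module _ (G : Graph) where

  reach-adjacent : ∀ {u v} → adj G u v ≡ true → reach G 1 u v ≡ true
  reach-adjacent {u} {v} uv =
    trans (cong ((u == v) ∨_) (any-true _ (∈-allFin u) u→v)) (∨-zeroʳ (u == v))
    where
    u→v : ((u == u) ∧ adj G u v) ≡ true
    u→v = trans (cong (_∧ adj G u v) (dec-true (u Fin.≟ u) refl)) uv

  reach-nonadjacent : ∀ {u v} → u ≢ v → adj G u v ≡ false → reach G 1 u v ≡ false
  reach-nonadjacent {u} {v} u≢v ¬uv rewrite dec-false (u Fin.≟ v) u≢v =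
    any-false _ (allFin (size G)) no-step
    where
    no-step : ∀ w → ((u == w) ∧ adj G w v) ≡ false
    no-step w with u Fin.≟ w
    ... | yes refl = ¬uv
    ... | no _     = refl

  reach-path₂ : ∀ {u v w} → adj G u w ≡ true → adj G w v ≡ true → reach G 2 u v ≡ true
  reach-path₂ {u} {v} {w} uw wv =
    trans (cong (reach G 1 u v ∨_) (any-true _ (∈-allFin w) u→w→v)) (∨-zeroʳ _)
    where
    u→w→v : (reach G 1 u w ∧ adj G w v) ≡ true
    u→w→v = trans (cong (_∧ adj G w v) (reach-adjacent uw)) wv

dist-refl : (G : Graph) (u : Fin (size G)) → dist G u u ≡ 0
dist-refl record { size = zero }  ()
dist-refl record { size = suc _ } u = if-cong (dec-true (u Fin.≟ u) refl)

dist-adjacent : (G : Graph) {u v : Fin (size G)} → u ≢ v → adj G u v ≡ true → dist G u v ≡ 1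
dist-adjacent record { size = suc zero } {Fin.zero} {Fin.zero} u≢v _ = ⊥-elim (u≢v refl)
dist-adjacent G@record { size = suc (suc _) } {u} {v} u≢v uv =
  trans (if-cong (dec-false (u Fin.≟ v) u≢v)) (if-cong (reach-adjacent G uv))

dist-two : (G : Graph) {u v w : Fin (size G)} → u ≢ v → adj G u v ≡ false →
           adj G u w ≡ true → adj G w v ≡ true → dist G u v ≡ 2
dist-two record { size = suc zero } {Fin.zero} {Fin.zero} u≢v _ _ _ = ⊥-elim (u≢v refl)
-- with two vertices the search stops at its bound size G = 2
dist-two G@record { size = suc (suc zero) } {u} {v} u≢v ¬uv _ _ =
  trans (if-cong (dec-false (u Fin.≟ v) u≢v)) (if-cong (reach-nonadjacent G u≢v ¬uv))
dist-two G@record { size = suc (suc (suc _)) } {u} {v} u≢v ¬uv uw wv =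
  trans (if-cong (dec-false (u Fin.≟ v) u≢v))
    (trans (if-cong (reach-nonadjacent G u≢v ¬uv)) (if-cong (reach-path₂ G uw wv)))

module _ (G : Graph) (u : Fin (size G)) where

  dist≤ecc : ∀ v → dist G u v ≤ ecc G u
  dist≤ecc v = go (∈-allFin v)
    where
    go : ∀ {vs} → v ∈ vs → dist G u v ≤ foldr (λ w acc → dist G u w ⊔ acc) 0 vs
    go (here refl)  = m≤m⊔n _ _
    go (there v∈vs) = ≤-trans (go v∈vs) (m≤n⊔m _ _)

  ecc≤ : ∀ {b} → (∀ v → dist G u v ≤ b) → ecc G u ≤ b
  ecc≤ {b} dist≤b = go (allFin (size G))
    where
    go : ∀ vs → foldr (λ w acc → dist G u w ⊔ acc) 0 vs ≤ b
    go []       = z≤n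
    go (w ∷ ws) = ⊔-lub (dist≤b w) (go ws)

module _ (G : Graph) {u v : Fin (size G)} where

  eccMatrix-attained : dist G u v ≡ ecc G u ⊓ ecc G v → eccMatrix G u v ≡ dist G u v
  eccMatrix-attained e = if-cong (dec-true (_ ℕ.≟ _) e)

  eccMatrix-unattained : dist G u v < ecc G u ⊓ ecc G v → eccMatrix G u v ≡ 0
  eccMatrix-unattained d< = if-cong (dec-false (_ ℕ.≟ _) (<⇒≢ d<))

module _ {n : ℕ} (N : Fin n → Fin n → ℕ) where

  -- Wherever σ places w, its row or its column crosses the zero block.
  hub⇒irreducible : (w : Fin n) → (∀ v → v ≢ w → N w v ≢ 0) → (∀ v → v ≢ w → N v w ≢ 0) →
                    Irreducible N
  hub⇒irreducible w out≢0 in≢0 (σ , r , 1≤r , r<n , block≡0) =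
    [ hubInLowerBlock , hubInUpperBlock ]′ (≤-<-connex r (toℕ p))
    where
    p : Fin n
    p = σ ⟨$⟩ˡ w

    ≢p⇒≢w : ∀ i → toℕ p ≢ toℕ i → σ ⟨$⟩ʳ i ≢ w
    ≢p⇒≢w i p≢i σi≡w = p≢i (cong toℕ (trans (cong (σ ⟨$⟩ˡ_) (sym σi≡w)) (inverseˡ σ)))

    hubInLowerBlock : r ≤ toℕ p → ⊥
    hubInLowerBlock r≤p =
      out≢0 (σ ⟨$⟩ʳ first) (≢p⇒≢w first (λ e → <⇒≱ first<r (subst (r ≤_) e r≤p)))
        (subst (λ z → N z (σ ⟨$⟩ʳ first) ≡ 0) (inverseʳ σ) (block≡0 p first r≤p first<r))
      where
      first<n : 0 < n
      first<n = ≤-trans 1≤r (<⇒≤ r<n)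
      first : Fin n
      first = fromℕ< first<n
      first<r : toℕ first < r
      first<r = subst (_< r) (sym (toℕ-fromℕ< first<n)) 1≤r

    hubInUpperBlock : toℕ p < r → ⊥
    hubInUpperBlock p<r =
      in≢0 (σ ⟨$⟩ʳ row) (≢p⇒≢w row (λ e → <⇒≱ p<r (subst (r ≤_) (sym e) r≤row)))
        (subst (λ z → N (σ ⟨$⟩ʳ row) z ≡ 0) (inverseʳ σ) (block≡0 row p r≤row p<r))
      where
      row : Fin n
      row = fromℕ< r<n
      r≤row : r ≤ toℕ row
      r≤row = ≤-reflexive (sym (toℕ-fromℕ< r<n))

lowerLeft≡0⇒reducible : ∀ {s a} (N : Fin (s + a) → Fin (s + a) → ℕ) → 1 ≤ s → 1 ≤ a →
                        (∀ x y → N (s ↑ʳ y) (x ↑ˡ a) ≡ 0) → Reducible N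
lowerLeft≡0⇒reducible {s} {a} N 1≤s 1≤a block≡0 = Perm.id , s , 1≤s , m<m+n s 1≤a , lowerLeft
  where
  lowerLeft : ∀ i j → s ≤ toℕ i → toℕ j < s → N i j ≡ 0
  lowerLeft i j s≤i j<s =
    subst₂ (λ i′ j′ → N i′ j′ ≡ 0)
      (splitAt⁻¹-↑ʳ (splitAt-≥ s i s≤i)) (splitAt⁻¹-↑ˡ (splitAt-< s j j<s))
      (block≡0 (fromℕ< j<s) (reduce≥ i s≤i))

exists-≢ : ∀ {a} → 2 ≤ a → (y : Fin a) → ∃ λ y′ → y ≢ y′
exists-≢ (s≤s (s≤s _)) y = punchIn y Fin.zero , λ e → punchInᵢ≢i y Fin.zero (sym e)

NoIsolatedVertex : Graph → Set
NoIsolatedVertex G = ∀ u → ∃ λ v → u ≢ v × adj G u v ≡ true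

-- C (suc (suc l)) α is by definition complUnionK (C (suc l) (α ∘ inject₁)) (α (fromℕ (suc l))).
complUnionK : Graph → ℕ → Graph
complUnionK H a = complG (unionG H (completeG a))

-- Old vertices x ↑ˡ a come from H, new vertices s ↑ʳ y from K_a.
module ComplUnionK (H : Graph) (a : ℕ) where

  s : ℕ
  s = size H

  G : Graph
  G = complUnionK H a

  adjacent-old-new : ∀ x y → adj G (x ↑ˡ a) (s ↑ʳ y) ≡ true
  adjacent-old-new x y
    rewrite splitAt-↑ˡ s x a | splitAt-↑ʳ s a y | dec-false (x ↑ˡ a Fin.≟ s ↑ʳ y) (↑ˡ≢↑ʳ x y) = refl

  adjacent-new-old : ∀ x y → adj G (s ↑ʳ y) (x ↑ˡ a) ≡ true
  adjacent-new-old x y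
    rewrite splitAt-↑ˡ s x a | splitAt-↑ʳ s a y
          | dec-false (s ↑ʳ y Fin.≟ x ↑ˡ a) (λ e → ↑ˡ≢↑ʳ x y (sym e)) = refl

  nonadjacent-new-new : ∀ {y y′} → y ≢ y′ → adj G (s ↑ʳ y) (s ↑ʳ y′) ≡ false
  nonadjacent-new-new {y} {y′} y≢y′
    rewrite splitAt-↑ʳ s a y | splitAt-↑ʳ s a y′ | dec-false (y Fin.≟ y′) y≢y′ = refl

  nonadjacent-old-old : ∀ {x x′} → adj H x x′ ≡ true → adj G (x ↑ˡ a) (x′ ↑ˡ a) ≡ false
  nonadjacent-old-old {x} {x′} xx′ rewrite splitAt-↑ˡ s x a | splitAt-↑ˡ s x′ a | xx′ = refl

  dist-old-new : ∀ x y → dist G (x ↑ˡ a) (s ↑ʳ y) ≡ 1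
  dist-old-new x y = dist-adjacent G (↑ˡ≢↑ʳ x y) (adjacent-old-new x y)

  dist-new-old : ∀ x y → dist G (s ↑ʳ y) (x ↑ˡ a) ≡ 1
  dist-new-old x y = dist-adjacent G (λ e → ↑ˡ≢↑ʳ x y (sym e)) (adjacent-new-old x y)

  noIsolatedVertex : 1 ≤ s → 1 ≤ a → NoIsolatedVertex G
  noIsolatedVertex 1≤s 1≤a u with ↑ˡ⊎↑ʳ s u
  ... | inj₁ (x , refl) = _ , ↑ˡ≢↑ʳ x _ , adjacent-old-new x (fromℕ< 1≤a)
  ... | inj₂ (y , refl) = _ , (λ e → ↑ˡ≢↑ʳ _ y (sym e)) , adjacent-new-old (fromℕ< 1≤s) y

  2≤ecc-new : Fin s → ∀ {y y′} → y ≢ y′ → 2 ≤ ecc G (s ↑ʳ y)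
  2≤ecc-new x {y} {y′} y≢y′ =
    subst (_≤ ecc G (s ↑ʳ y))
      (dist-two G (λ e → y≢y′ (↑ʳ-injective s y y′ e)) (nonadjacent-new-new y≢y′)
        (adjacent-new-old x y) (adjacent-old-new x y′))
      (dist≤ecc G (s ↑ʳ y) (s ↑ʳ y′))

  2≤ecc-old : Fin a → ∀ {x x′} → x ≢ x′ → adj H x x′ ≡ true → 2 ≤ ecc G (x ↑ˡ a)
  2≤ecc-old y {x} {x′} x≢x′ xx′ =
    subst (_≤ ecc G (x ↑ˡ a))
      (dist-two G (λ e → x≢x′ (↑ˡ-injective a x x′ e)) (nonadjacent-old-old xx′)
        (adjacent-old-new x y) (adjacent-new-old x′ y))
      (dist≤ecc G (x ↑ˡ a) (x′ ↑ˡ a))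

  eccMatrix-new-old≡0 : 2 ≤ a → NoIsolatedVertex H → ∀ x y → eccMatrix G (s ↑ʳ y) (x ↑ˡ a) ≡ 0
  eccMatrix-new-old≡0 2≤a noIsolated x y with exists-≢ 2≤a y | noIsolated x
  ... | _ , y≢y′ | _ , x≢x′ , xx′ =
    eccMatrix-unattained G
      (subst (_< ecc G (s ↑ʳ y) ⊓ ecc G (x ↑ˡ a)) (sym (dist-new-old x y))
        (⊓-glb (2≤ecc-new x y≢y′) (2≤ecc-old y x≢x′ xx′)))

complUnionK-reducible : (H : Graph) (a : ℕ) → 1 ≤ size H → 2 ≤ a → NoIsolatedVertex H →
                        Reducible (eccMatrix (complUnionK H a))
complUnionK-reducible H a 1≤s 2≤a noIsolated =
  lowerLeft≡0⇒reducible (eccMatrix G) 1≤s (<⇒≤ 2≤a) (eccMatrix-new-old≡0 2≤a noIsolated)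
  where open ComplUnionK H a

module Hub (H : Graph) (1≤s : 1 ≤ size H) where
  open ComplUnionK H 1

  hub : Fin (size G)
  hub = s ↑ʳ Fin.zero

  old-if-≢hub : ∀ v → v ≢ hub → ∃ λ x → v ≡ x ↑ˡ 1
  old-if-≢hub v v≢hub with ↑ˡ⊎↑ʳ s v
  ... | inj₁ old                = old
  ... | inj₂ (Fin.zero , v≡hub) = ⊥-elim (v≢hub v≡hub)

  dist-from-hub : ∀ v → v ≢ hub → dist G hub v ≡ 1
  dist-from-hub v v≢hub with old-if-≢hub v v≢hub
  ... | x , refl = dist-new-old x Fin.zero

  dist-to-hub : ∀ v → v ≢ hub → dist G v hub ≡ 1
  dist-to-hub v v≢hub with old-if-≢hub v v≢hub
  ... | x , refl = dist-old-new x Fin.zero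

  1≤ecc : ∀ v → v ≢ hub → 1 ≤ ecc G v
  1≤ecc v v≢hub = subst (_≤ ecc G v) (dist-to-hub v v≢hub) (dist≤ecc G v hub)

  ecc-hub : ecc G hub ≡ 1
  ecc-hub =
    ≤-antisym (ecc≤ G hub dist≤1) (subst (_≤ ecc G hub) (dist-from-hub old old≢hub) (dist≤ecc G hub old))
    where
    old : Fin (size G)
    old = fromℕ< 1≤s ↑ˡ 1
    old≢hub : old ≢ hub
    old≢hub = ↑ˡ≢↑ʳ (fromℕ< 1≤s) Fin.zero
    dist≤1 : ∀ v → dist G hub v ≤ 1
    dist≤1 v with v Fin.≟ hub
    ... | yes refl  = subst (_≤ 1) (sym (dist-refl G hub)) z≤n
    ... | no  v≢hub = ≤-reflexive (dist-from-hub v v≢hub)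

  eccMatrix-from-hub : ∀ v → v ≢ hub → eccMatrix G hub v ≡ 1
  eccMatrix-from-hub v v≢hub = trans (eccMatrix-attained G (trans d≡1 (sym ecc⊓≡1))) d≡1
    where
    d≡1 : dist G hub v ≡ 1
    d≡1 = dist-from-hub v v≢hub
    ecc⊓≡1 : ecc G hub ⊓ ecc G v ≡ 1
    ecc⊓≡1 = trans (cong (_⊓ ecc G v) ecc-hub) (m≤n⇒m⊓n≡m (1≤ecc v v≢hub))

  eccMatrix-to-hub : ∀ v → v ≢ hub → eccMatrix G v hub ≡ 1
  eccMatrix-to-hub v v≢hub = trans (eccMatrix-attained G (trans d≡1 (sym ecc⊓≡1))) d≡1
    where
    d≡1 : dist G v hub ≡ 1
    d≡1 = dist-to-hub v v≢hub
    ecc⊓≡1 : ecc G v ⊓ ecc G hub ≡ 1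
    ecc⊓≡1 = trans (cong (ecc G v ⊓_) ecc-hub) (m≥n⇒m⊓n≡n (1≤ecc v v≢hub))

complUnionK-irreducible : (H : Graph) → 1 ≤ size H → Irreducible (eccMatrix (complUnionK H 1))
complUnionK-irreducible H 1≤s =
  hub⇒irreducible (eccMatrix G) hub
    (λ v v≢hub → ≡1⇒≢0 (eccMatrix-from-hub v v≢hub))
    (λ v v≢hub → ≡1⇒≢0 (eccMatrix-to-hub v v≢hub))
  where
  open ComplUnionK H 1 using (G)
  open Hub H 1≤s
  ≡1⇒≢0 : ∀ {m} → m ≡ 1 → m ≢ 0
  ≡1⇒≢0 refl ()

1≤size-C : ∀ m (α : Fin (suc m) → ℕ) → (∀ i → 1 ≤ α i) → 1 ≤ size (C (suc m) α)
1≤size-C zero    α 1≤α = 1≤α Fin.zero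
1≤size-C (suc m) α 1≤α = ≤-trans (1≤size-C m (α ∘ inject₁) (1≤α ∘ inject₁)) (m≤m+n _ _)

eccMatrix-C : ∀ l → 3 ≤ l → (α : Fin l → ℕ) → (∀ i → 1 ≤ α i) →
              (lastEntry l α ≡ 1 → Irreducible (eccMatrix (C l α))) ×
              (2 ≤ lastEntry l α → Reducible (eccMatrix (C l α)))
eccMatrix-C (suc (suc (suc m))) (s≤s (s≤s (s≤s z≤n))) α 1≤α =
  (λ a≡1 → subst (λ a → Irreducible (eccMatrix (complUnionK H a))) (sym a≡1)
             (complUnionK-irreducible H 1≤|H|))
  , (λ 2≤a → complUnionK-reducible H _ 1≤|H| 2≤a
               (ComplUnionK.noIsolatedVertex H₀ _ (1≤size-C m _ (1≤α ∘ inject₁ ∘ inject₁))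
                 (1≤α (inject₁ (Fin.fromℕ (suc m))))))
  where
  H₀ H : Graph
  H₀ = C (suc m) (α ∘ inject₁ ∘ inject₁)
  H  = C (suc (suc m)) (α ∘ inject₁)
  1≤|H| : 1 ≤ size H
  1≤|H| = 1≤size-C (suc m) _ (1≤α ∘ inject₁)

mainTheorem1 : (k : ℕ) → 2 ≤ k → (α : Fin (2 * k) → ℕ) → (∀ i → 1 ≤ α i) →
    (lastEntry (2 * k) α ≡ 1 → Irreducible (eccMatrix (C (2 * k) α))) ×
    (2 ≤ lastEntry (2 * k) α → Reducible (eccMatrix (C (2 * k) α)))
mainTheorem1 k 2≤k = eccMatrix-C (2 * k) (≤-trans (n≤1+n 3) (*-monoʳ-≤ 2 2≤k))
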